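{- Let $b\ge 2$, $m\ge1$ be integers, $\Sigma$ an alphabet with $m$ letters, $\sigma$ a cyclic permutation of $\Sigma$ (a single $m$-cycle), $\overline{\alpha}\in\Sigma$, and $\mathbf{t}$ the corresponding generalized Thue–Morse word. Let $w$ be a $\sigma$-cyclic factor of $\mathbf{t}$. If some occurrence of $w$ in $\mathbf{t}$ overlaps three consecutive blocks, then $\mathbf{t}$ is periodic.
   Context: $\mu(\alpha)=\alpha\,\sigma(\alpha)\cdots\sigma^{b-1}(\alpha)$ and $\mathbf{t}=\lim_n\mu^n(\overline{\alpha})=\mathbf{t}[0]\mathbf{t}[1]\cdots$, so $\mathbf{t}=\mu(\mathbf{t}[0])\mu(\mathbf{t}[1])\cdots$. The blocks of $\mathbf{t}$ are the factors $\mathbf{t}[jb]\cdots\mathbf{t}[jb+b-1]$, $j\ge0$ (images of letters under $\mu$). An occurrence at position $i$ of $w$ overlaps three consecutive blocks if the interval $[i,i+|w|-1]$ meets each of $[jb,jb+b-1]$, $[(j+1)b,(j+1)b+b-1]$, $[(j+2)b,(j+2)b+b-1]$ for some $j$. A word $w_0w_1\cdots w_{\ell-1}$ is $\sigma$-cyclic if $w_i=\sigma(w_{i-1})$ for $1\le i\le \ell-1$. An infinite word is periodic if it equals $v^\omega=vvv\cdots$ for some nonempty finite word $v$. -}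

module Defs where

open import Data.Nat using (ℕ; zero; suc; _+_; _*_; _≤_; _<_)
open import Data.Nat.DivMod using (_mod_)
open import Data.Fin using (Fin)
open import Data.List using (List; []; _∷_; map; concatMap; upTo; length)
open import Data.Vec using (Vec) renaming (lookup to vlookup)
open import Data.Product using (Σ; ∃; _×_; _,_)
open import Function using (Injective; _∘_)
open import Relation.Binary.PropositionalEquality using (_≡_)

iter : {A : Set} → (A → A) → ℕ → A → A
iter f zero    x = x
iter f (suc n) x = f (iter f n x)

-- σ is a cyclic permutation of Σ = Fin m consisting of a single m-cycle:
-- a bijection (injective self-map of a finite set) all of whose points lie in one orbit.
IsCyclicPerm : (m : ℕ) → (Fin m → Fin m) → Set
IsCyclicPerm m σ = Injective _≡_ _≡_ σ × (∀ x y → ∃ λ k → iter σ k x ≡ y)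

μ : ∀ {m} → ℕ → (Fin m → Fin m) → List (Fin m) → List (Fin m)
μ b σ = concatMap (λ a → map (λ r → iter σ r a) (upTo b))

nth : {A : Set} → A → List A → ℕ → A
nth d []      _       = d
nth d (x ∷ _) zero    = x
nth d (_ ∷ xs) (suc i) = nth d xs i

-- The generalized Thue–Morse word t = lim_n μ^n(ᾱ).
-- Since |μ^{i+1}(ᾱ)| = b^{i+1} > i (for b ≥ 2) and μ^n(ᾱ) is a prefix of μ^{n+1}(ᾱ),
-- t[i] is the i-th letter of μ^{i+1}(ᾱ); the default is never used when b ≥ 2.
tm : ∀ {m} → ℕ → (Fin m → Fin m) → Fin m → ℕ → Fin m
tm b σ α i = nth α (iter (μ b σ) (suc i) (α ∷ [])) i

OccursAt : ∀ {m} → (ℕ → Fin m) → List (Fin m) → ℕ → Set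
OccursAt t w i = ∀ k → k < length w → t (i + k) ≡ nth (t i) w k

SigmaCyclic : ∀ {m} → (Fin m → Fin m) → List (Fin m) → Set
SigmaCyclic σ []           = Data.Unit.⊤ where import Data.Unit
SigmaCyclic σ (x ∷ [])     = Data.Unit.⊤ where import Data.Unit
SigmaCyclic σ (x ∷ y ∷ ws) = (y ≡ σ x) × SigmaCyclic σ (y ∷ ws)

Meets : ℕ → ℕ → ℕ → ℕ → Set
Meets b i ℓ j = ∃ λ k → (i ≤ k) × (k < i + ℓ) × (j * b ≤ k) × (k < j * b + b)

OverlapsThreeBlocks : ℕ → ℕ → ℕ → Set
OverlapsThreeBlocks b i ℓ =
  ∃ λ j → Meets b i ℓ j × Meets b i ℓ (suc j) × Meets b i ℓ (suc (suc j))

Periodic : {A : Set} → (ℕ → A) → Set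
Periodic {A} x = ∃ λ p → Σ (Vec A (suc p)) λ v → ∀ n → x n ≡ vlookup v (n mod suc p)

module Submission where

-- At a boundary between two blocks inside the occurrence, the last letter σ^(b-1)(t q)
-- of block q is followed by the first letter t (q+1) of block q+1; σ-cyclicity of w
-- forces t (q+1) = σ^b (t q). Spanning three blocks yields this for two consecutive q,
-- and one of the positions q, q+1 is not the last of its own block, where also
-- t (x+1) = σ (t x); injectivity of σ then gives a point fixed by σ^(b-1). As σ is a
-- single cycle, σ^(b-1) is the identity, so t n = σ^n(ᾱ) for all n and t has period b-1.

open import Defs
open import Data.Nat using (ℕ; zero; suc; _+_; _*_; _≤_; _<_; z≤n; s≤s; _<?_)
open import Data.Nat.Properties
open import Data.Nat.DivMod using (_/_; _%_; _mod_; m≡m%n+[m/n]*n; m%n<n; m/n<m)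
open import Data.Nat.Induction using (<-rec)
open import Data.Nat.Tactic.RingSolver using (solve-∀)
open import Data.Fin using (Fin; toℕ)
open import Data.Fin.Properties using (toℕ-fromℕ<)
open import Data.List using (List; []; _∷_; _++_; map; upTo; applyUpTo; length)
open import Data.List.Properties using (length-map; length-++; length-upTo; concatMap-++; ++-assoc; ++-identityʳ)
open import Data.Vec using (tabulate; lookup)
open import Data.Vec.Properties using (lookup∘tabulate)
open import Data.Product using (∃; ∃₂; _×_; _,_; proj₂)
open import Data.Sum using (_⊎_; inj₁; inj₂)
open import Relation.Nullary using (yes; no)
open import Relation.Binary.PropositionalEquality
open import Function using (Injective)

open ≡-Reasoning

module _ {A : Set} (f : A → A) where

  iter-+ : ∀ m n x → iter f (m + n) x ≡ iter f m (iter f n x)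
  iter-+ zero    n x = refl
  iter-+ (suc m) n x = cong f (iter-+ m n x)

  iter-comm : ∀ m n x → iter f m (iter f n x) ≡ iter f n (iter f m x)
  iter-comm m n x = begin
    iter f m (iter f n x) ≡⟨ iter-+ m n x ⟨
    iter f (m + n) x      ≡⟨ cong (λ k → iter f k x) (+-comm m n) ⟩
    iter f (n + m) x      ≡⟨ iter-+ n m x ⟩
    iter f n (iter f m x) ∎

  iter-fixes-all : (∀ x y → ∃ λ k → iter f k x ≡ y) →
                   ∀ e u → iter f e u ≡ u → ∀ x → iter f e x ≡ x
  iter-fixes-all orbit e u fixed x with orbit u x
  ... | k , refl = trans (iter-comm e k u) (cong (iter f k) fixed)

  module _ {e : ℕ} (iter-e≡id : ∀ x → iter f e x ≡ x) where

    iter-*-id : ∀ q x → iter f (q * e) x ≡ x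
    iter-*-id zero    x = refl
    iter-*-id (suc q) x = trans (iter-+ e (q * e) x) (trans (iter-e≡id _) (iter-*-id q x))

    iter-*-+ : ∀ q n x → iter f (q * e + n) x ≡ iter f n x
    iter-*-+ q n x = begin
      iter f (q * e + n) x          ≡⟨ cong (λ k → iter f k x) (+-comm (q * e) n) ⟩
      iter f (n + q * e) x          ≡⟨ iter-+ n (q * e) x ⟩
      iter f n (iter f (q * e) x)   ≡⟨ cong (iter f n) (iter-*-id q x) ⟩
      iter f n x                    ∎

  iterate-periodic : ∀ p → (∀ x → iter f (suc p) x ≡ x) → ∀ x → Periodic (λ n → iter f n x)
  iterate-periodic p iter-p+1≡id x = p , tabulate (λ k → iter f (toℕ k) x) , λ n → begin
    iter f n x                                       ≡⟨ cong (λ k → iter f k x) (m≡m%n+[m/n]*n n (suc p)) ⟩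
    iter f (n % suc p + n / suc p * suc p) x         ≡⟨ iter-+ (n % suc p) (n / suc p * suc p) x ⟩
    iter f (n % suc p) (iter f (n / suc p * suc p) x) ≡⟨ cong (iter f (n % suc p)) (iter-*-id iter-p+1≡id (n / suc p) x) ⟩
    iter f (n % suc p) x                             ≡⟨ cong (λ k → iter f k x) (toℕ-fromℕ< (m%n<n n (suc p))) ⟨
    iter f (toℕ (n mod suc p)) x                     ≡⟨ lookup∘tabulate (λ k → iter f (toℕ k) x) (n mod suc p) ⟨
    lookup (tabulate (λ k → iter f (toℕ k) x)) (n mod suc p) ∎

Periodic-≗ : {A : Set} {x y : ℕ → A} → (∀ n → x n ≡ y n) → Periodic y → Periodic x
Periodic-≗ x≗y (p , v , y-periodic) = p , v , λ n → trans (x≗y n) (y-periodic n)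

module _ {A : Set} (d : A) where

  nth-++ˡ : ∀ xs ys {i} → i < length xs → nth d (xs ++ ys) i ≡ nth d xs i
  nth-++ˡ (x ∷ xs) ys {zero}  _         = refl
  nth-++ˡ (x ∷ xs) ys {suc i} (s≤s i<n) = nth-++ˡ xs ys i<n

  nth-++ʳ : ∀ xs ys i → nth d (xs ++ ys) (length xs + i) ≡ nth d ys i
  nth-++ʳ []       ys i = refl
  nth-++ʳ (x ∷ xs) ys i = nth-++ʳ xs ys i

  nth-extension : ∀ xs {ys zs i} → ys ≡ xs ++ zs → i < length xs → nth d ys i ≡ nth d xs i
  nth-extension xs {zs = zs} refl = nth-++ˡ xs zs

  nth-map-applyUpTo : ∀ (g : ℕ → A) (f : ℕ → ℕ) n {r} → r < n → nth d (map g (applyUpTo f n)) r ≡ g (f r)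
  nth-map-applyUpTo g f (suc n) {zero}  _         = refl
  nth-map-applyUpTo g f (suc n) {suc r} (s≤s r<n) = nth-map-applyUpTo g (λ k → f (suc k)) n r<n

SigmaCyclic-nth : ∀ {m} (σ : Fin m → Fin m) d w {k} → SigmaCyclic σ w →
                  suc k < length w → nth d w (suc k) ≡ σ (nth d w k)
SigmaCyclic-nth σ d (x ∷ []) _ (s≤s ())
SigmaCyclic-nth σ d (x ∷ y ∷ ws) {zero}  (y≡σx , _) _                = y≡σx
SigmaCyclic-nth σ d (x ∷ y ∷ ws) {suc k} (_ , cyclic) (s≤s k+1<len) = SigmaCyclic-nth σ d (y ∷ ws) cyclic k+1<len

occurrence-step : ∀ {m} {σ : Fin m → Fin m} {t : ℕ → Fin m} {w i n} →
                  SigmaCyclic σ w → OccursAt t w i →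
                  i ≤ n → suc n < i + length w → t (suc n) ≡ σ (t n)
occurrence-step {σ = σ} {t} {w} {i} cyclic occ i≤n n+1<end with m≤n⇒∃[o]m+o≡n i≤n
... | k , refl = begin
  t (suc (i + k))       ≡⟨ cong t (+-suc i k) ⟨
  t (i + suc k)         ≡⟨ occ (suc k) k+1<len ⟩
  nth (t i) w (suc k)   ≡⟨ SigmaCyclic-nth σ (t i) w cyclic k+1<len ⟩
  σ (nth (t i) w k)     ≡⟨ cong σ (occ k (<-trans (n<1+n k) k+1<len)) ⟨
  σ (t (i + k))         ∎
  where
    k+1<len : suc k < length w
    k+1<len = +-cancelˡ-< i (suc k) (length w) (subst (_< i + length w) (sym (+-suc i k)) n+1<end)

module _ {m} (b : ℕ) (σ : Fin m → Fin m) where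

  block : Fin m → List (Fin m)
  block a = map (λ r → iter σ r a) (upTo b)

  length-block : ∀ a → length (block a) ≡ b
  length-block a = trans (length-map _ (upTo b)) (length-upTo b)

  length-μ : ∀ L → length (μ b σ L) ≡ length L * b
  length-μ []      = refl
  length-μ (x ∷ L) = trans (length-++ (block x)) (cong₂ _+_ (length-block x) (length-μ L))

  nth-μ : ∀ d L q {r} → q < length L → r < b → nth d (μ b σ L) (q * b + r) ≡ iter σ r (nth d L q)
  nth-μ d (x ∷ L) zero    {r} _ r<b = begin
    nth d (block x ++ μ b σ L) r ≡⟨ nth-++ˡ d (block x) (μ b σ L) (subst (r <_) (sym (length-block x)) r<b) ⟩
    nth d (block x) r            ≡⟨ nth-map-applyUpTo d (λ r → iter σ r x) (λ k → k) b r<b ⟩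
    iter σ r x                   ∎
  nth-μ d (x ∷ L) (suc q) {r} (s≤s q<len) r<b = begin
    nth d (block x ++ μ b σ L) (b + q * b + r)                  ≡⟨ cong (nth d (block x ++ μ b σ L)) (+-assoc b (q * b) r) ⟩
    nth d (block x ++ μ b σ L) (b + (q * b + r))                ≡⟨ cong (λ k → nth d (block x ++ μ b σ L) (k + (q * b + r))) (length-block x) ⟨
    nth d (block x ++ μ b σ L) (length (block x) + (q * b + r)) ≡⟨ nth-++ʳ d (block x) (μ b σ L) (q * b + r) ⟩
    nth d (μ b σ L) (q * b + r)                                 ≡⟨ nth-μ d L q q<len r<b ⟩
    iter σ r (nth d L q)                                        ∎

next-block-start : ∀ c q → suc (q * suc (suc c) + suc c) ≡ suc q * suc (suc c) + 0
next-block-start = solve-∀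

block-position-regroup : ∀ c q r → q * suc (suc c) + r ≡ q * suc c + (r + q)
block-position-regroup = solve-∀

-- Blocks have length b = c + 2, so that b ≥ 2 and the eventual period b - 1 is suc c.
module ThueMorse {m} (c : ℕ) (σ : Fin m → Fin m) (α : Fin m) where

  b : ℕ
  b = suc (suc c)

  t : ℕ → Fin m
  t = tm b σ α

  T : ℕ → List (Fin m)
  T n = iter (μ b σ) n (α ∷ [])

  length-T : ∀ n → suc n ≤ length (T n)
  length-T zero    = s≤s z≤n
  length-T (suc n) = subst (suc (suc n) ≤_) (sym (length-μ b σ (T n)))
    (<-≤-trans (m<m*n (suc n) b (s≤s (s≤s z≤n))) (*-monoˡ-≤ b (length-T n)))

  T-step : ∀ n → ∃ λ R → T (suc n) ≡ T n ++ R
  T-step zero = _ , refl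
  T-step (suc n) with T-step n
  ... | R , T-n+1 = μ b σ R , trans (cong (μ b σ) T-n+1) (concatMap-++ _ (T n) R)

  T-prefix : ∀ k n → ∃ λ R → T (k + n) ≡ T n ++ R
  T-prefix zero    n = [] , sym (++-identityʳ (T n))
  T-prefix (suc k) n with T-prefix k n | T-step (k + n)
  ... | R , T-k+n | R' , T-k+n+1 =
    R ++ R' , trans T-k+n+1 (trans (cong (_++ R') T-k+n) (++-assoc (T n) R R'))

  tm-nth-T : ∀ n {i} → i < length (T n) → t i ≡ nth α (T n) i
  tm-nth-T n {i} i<len = begin
    nth α (T (suc i)) i     ≡⟨ nth-extension α (T (suc i)) (proj₂ (T-prefix n (suc i))) (<-trans (n<1+n i) (length-T (suc i))) ⟨
    nth α (T (n + suc i)) i ≡⟨ cong (λ k → nth α (T k) i) (+-comm n (suc i)) ⟩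
    nth α (T (suc i + n)) i ≡⟨ nth-extension α (T n) (proj₂ (T-prefix (suc i) n)) i<len ⟩
    nth α (T n) i           ∎

  tm-block : ∀ q {r} → r < b → t (q * b + r) ≡ iter σ r (t q)
  tm-block q {r} r<b = begin
    t (q * b + r)                           ≡⟨⟩
    nth α (T (suc (q * b + r))) (q * b + r) ≡⟨ nth-μ b σ α (T (q * b + r)) q q<len r<b ⟩
    iter σ r (nth α (T (q * b + r)) q)      ≡⟨ cong (iter σ r) (tm-nth-T (q * b + r) q<len) ⟨
    iter σ r (t q)                          ∎
    where
      q<len : q < length (T (q * b + r))
      q<len = ≤-trans (s≤s (≤-trans (m≤m*n q b) (m≤m+n (q * b) r))) (length-T (q * b + r))

  tm-step-inside-block : ∀ q {r} → suc r < b → t (suc (q * b + r)) ≡ σ (t (q * b + r))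
  tm-step-inside-block q {r} r+1<b = begin
    t (suc (q * b + r))    ≡⟨ cong t (+-suc (q * b) r) ⟨
    t (q * b + suc r)      ≡⟨ tm-block q r+1<b ⟩
    σ (iter σ r (t q))     ≡⟨ cong σ (tm-block q (<-trans (n<1+n r) r+1<b)) ⟨
    σ (t (q * b + r))      ∎

  div-mod : ∀ n → n ≡ n / b * b + n % b
  div-mod n = trans (m≡m%n+[m/n]*n n b) (+-comm (n % b) (n / b * b))

  position-not-last-in-block : ∀ j → ∃₂ λ q r → suc r < b × (j ≡ q * b + r ⊎ suc j ≡ q * b + r)
  position-not-last-in-block j with suc (j % b) <? b
  ... | yes r+1<b = j / b , j % b , r+1<b , inj₁ (div-mod j)
  ... | no  r+1≮b = suc (j / b) , 0 , s≤s (s≤s z≤n) , inj₂ (begin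
    suc j                         ≡⟨ cong suc (div-mod j) ⟩
    suc (j / b * b + j % b)       ≡⟨ cong (λ r → suc (j / b * b + r)) j%b≡b-1 ⟩
    suc (j / b * b + suc c)       ≡⟨ next-block-start c (j / b) ⟩
    suc (j / b) * b + 0           ∎)
    where
      j%b≡b-1 : j % b ≡ suc c
      j%b≡b-1 = ≤-antisym (≤-pred (m%n<n j b)) (≤-pred (≮⇒≥ r+1≮b))

  tm-boundary : ∀ q → t (suc (q * b + suc c)) ≡ σ (t (q * b + suc c)) → t (suc q) ≡ iter σ b (t q)
  tm-boundary q continues = begin
    t (suc q)                 ≡⟨ tm-block (suc q) (s≤s z≤n) ⟨
    t (suc q * b + 0)         ≡⟨ cong t (next-block-start c q) ⟨
    t (suc (q * b + suc c))   ≡⟨ continues ⟩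
    σ (t (q * b + suc c))     ≡⟨ cong σ (tm-block q ≤-refl) ⟩
    iter σ b (t q)            ∎

  overlap-boundaries : ∀ {i ℓ} → OverlapsThreeBlocks b i ℓ →
                       ∃ λ j → i ≤ j * b + suc c × suc (suc j * b + suc c) < i + ℓ
  overlap-boundaries (j , (k , i≤k , _ , _ , k<end-j) , _ , (k' , _ , k'<i+ℓ , start-j+2≤k' , _)) =
    j , ≤-trans i≤k (≤-pred (subst (suc k ≤_) (+-suc (j * b) (suc c)) k<end-j))
      , ≤-<-trans (subst (_≤ k') (sym (trans (next-block-start c (suc j)) (+-identityʳ _))) start-j+2≤k') k'<i+ℓ

  tm-closed-form : (∀ x → iter σ (suc c) x ≡ x) → ∀ n → t n ≡ iter σ n α
  tm-closed-form σ^[b-1]≡id = <-rec (λ n → t n ≡ iter σ n α) closed-form-at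
    where
      closed-form-at : ∀ n → (∀ {q} → q < n → t q ≡ iter σ q α) → t n ≡ iter σ n α
      closed-form-at zero    _  = refl
      closed-form-at n@(suc _) ih = begin
        t n                                  ≡⟨ cong t (div-mod n) ⟩
        t (q * b + r)                        ≡⟨ tm-block q (m%n<n n b) ⟩
        iter σ r (t q)                       ≡⟨ cong (iter σ r) (ih (m/n<m n b (s≤s (s≤s z≤n)))) ⟩
        iter σ r (iter σ q α)                ≡⟨ iter-+ σ r q α ⟨
        iter σ (r + q) α                     ≡⟨ iter-*-+ σ σ^[b-1]≡id q (r + q) α ⟨
        iter σ (q * suc c + (r + q)) α       ≡⟨ cong (λ k → iter σ k α) (block-position-regroup c q r) ⟨
        iter σ (q * b + r) α                 ≡⟨ cong (λ k → iter σ k α) (div-mod n) ⟨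
        iter σ n α                           ∎
        where
          q = n / b
          r = n % b

  module _ (σ-injective : Injective _≡_ _≡_ σ) where

    fixed-point-inside-block : ∀ x q {r} → x ≡ q * b + r → suc r < b →
                               t (suc x) ≡ iter σ b (t x) → iter σ (suc c) (t x) ≡ t x
    fixed-point-inside-block _ q refl r+1<b jump = σ-injective (trans (sym jump) (tm-step-inside-block q r+1<b))

    consecutive-jumps⇒fixed-point : ∀ j → t (suc j) ≡ iter σ b (t j) → t (suc (suc j)) ≡ iter σ b (t (suc j)) →
                                    ∃ λ u → iter σ (suc c) u ≡ u
    consecutive-jumps⇒fixed-point j jump jump′ with position-not-last-in-block j
    ... | q , r , r+1<b , inj₁ j≡   = t j       , fixed-point-inside-block j       q j≡ r+1<b jump
    ... | q , r , r+1<b , inj₂ j+1≡ = t (suc j) , fixed-point-inside-block (suc j) q j+1≡ r+1<b jump′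

    three-block-occurrence⇒fixed-point : ∀ {w i} → SigmaCyclic σ w → OccursAt t w i →
                                         OverlapsThreeBlocks b i (length w) → ∃ λ u → iter σ (suc c) u ≡ u
    three-block-occurrence⇒fixed-point {w} {i} cyclic occ spans with overlap-boundaries spans
    ... | j , i≤end-j , end-j+1<end =
      consecutive-jumps⇒fixed-point j (tm-boundary j (step i≤end-j end-j<end))
                                      (tm-boundary (suc j) (step (≤-trans i≤end-j end-j≤end-j+1) end-j+1<end))
      where
        step : ∀ {n} → i ≤ n → suc n < i + length w → t (suc n) ≡ σ (t n)
        step = occurrence-step cyclic occ
        end-j≤end-j+1 : j * b + suc c ≤ suc j * b + suc c
        end-j≤end-j+1 = +-monoˡ-≤ (suc c) (m≤n+m (j * b) b)
        end-j<end : suc (j * b + suc c) < i + length w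
        end-j<end = ≤-<-trans (s≤s end-j≤end-j+1) end-j+1<end

lemma3p2 : (b m : ℕ) → 2 ≤ b → 1 ≤ m → (σ : Fin m → Fin m) → IsCyclicPerm m σ →
           (α : Fin m) → (w : List (Fin m)) → SigmaCyclic σ w →
           (∃ λ i → OccursAt (tm b σ α) w i × OverlapsThreeBlocks b i (length w)) →
           Periodic (tm b σ α)
lemma3p2 (suc (suc c)) _ _ _ σ (σ-injective , σ-orbit) α w cyclic (i , occ , spans) =
  Periodic-≗ (tm-closed-form σ^[b-1]≡id) (iterate-periodic σ c σ^[b-1]≡id α)
  where
    open ThueMorse c σ α
    σ^[b-1]≡id : ∀ x → iter σ (suc c) x ≡ x
    σ^[b-1]≡id with three-block-occurrence⇒fixed-point σ-injective cyclic occ spans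
    ... | u , fixed = iter-fixes-all σ σ-orbit (suc c) u fixed
lemma3p2 (suc zero) _ (s≤s ()) _ _ _ _ _ _ _
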